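{- Let $p$ be a prime, $q$ a power of $p$, and $m \in \mathbb{F}_q$. Let $F(p,m) = (a_{i,j})_{0 \le i,j \le p-1}$ be the $p \times p$ matrix over $\mathbb{F}_q$ defined by $a_{i,0} = a_{0,j} = 1$ and $a_{i,j} = a_{i-1,j} + m \, a_{i-1,j-1} + a_{i,j-1}$ for $i,j \geq 1$. Then the last row and the last column of $F(p,m)$ are both $1, -m, (-m)^2, \dots, (-m)^{p-1}$, i.e. $a_{p-1,k} = a_{k,p-1} = (-m)^k$ for $0 \le k \le p-1$. This holds also for $m = 0$.
   Context: The convention $(-m)^0 = 1$ is used, also when $m=0$. Matrices are indexed from $0$. -}

module Defs where

open import Level using (Level; _⊔_)
open import Data.Nat using (ℕ; zero; suc)
open import Data.Fin using (Fin)
open import Data.Product using (Σ)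
open import Relation.Nullary using (¬_)
open import Relation.Binary.PropositionalEquality as ≡ using (_≡_)
open import Function.Bundles using (Bijection)
open import Algebra.Bundles using (CommutativeRing; Semiring)
import Algebra.Definitions.RawSemiring as RS

record IsField {c ℓ : Level} (R : CommutativeRing c ℓ) : Set (c ⊔ ℓ) where
  open CommutativeRing R
  field
    1≉0     : ¬ (1# ≈ 0#)
    inverse : ∀ x → ¬ (x ≈ 0#) → Σ Carrier (λ y → (x * y) ≈ 1#)

record IsFiniteFieldOfSize {c ℓ : Level} (R : CommutativeRing c ℓ) (q : ℕ) : Set (c ⊔ ℓ) where
  field
    isField : IsField R
    card    : Bijection (≡.setoid (Fin q)) (CommutativeRing.setoid R)

-- The matrix F(p,m) (all entries a_{i,j}, i,j ∈ ℕ; F(p,m) is the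
-- restriction to 0 ≤ i,j ≤ p-1):
--   a_{i,0} = a_{0,j} = 1,
--   a_{i,j} = a_{i-1,j} + m a_{i-1,j-1} + a_{i,j-1}   (i,j ≥ 1).
module _ {c ℓ : Level} (R : CommutativeRing c ℓ) where
  open CommutativeRing R

  Fentry : Carrier → ℕ → ℕ → Carrier
  Fentry m zero    j       = 1#
  Fentry m (suc i) zero    = 1#
  Fentry m (suc i) (suc j) = (Fentry m i (suc j) + m * Fentry m i j) + Fentry m (suc i) j

  -- power with x ^ 0 = 1 (so (-m)^0 = 1 also for m = 0)
  pow : Carrier → ℕ → Carrier
  pow = RS._^_ (Semiring.rawSemiring semiring)

{-# OPTIONS --safe #-}
-- Since Σ_l C(i,l) C(j,l) (1+m)^l satisfies the recurrence of F(p,m), it equals a_{i,j}.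
-- In characteristic p, C(p-1,l) + C(p-1,l+1) = C(p,l+1) = 0 for l+1 < p, so
-- C(p-1,l) = (-1)^l and the binomial theorem gives
-- a_{k,p-1} = Σ_l C(k,l) (-(1+m))^l = (1 - (1+m))^k = (-m)^k; the last row follows
-- from the symmetry a_{i,j} = a_{j,i} of the recurrence. A field with q = p^n
-- elements has characteristic p: translation by 1 permutes its elements, so q·1 = 0,
-- and p·1 is then nilpotent, hence zero.
module Submission where

open import Defs
open import Level using (Level)
open import Data.Nat as ℕ using (ℕ; zero; suc; _∸_; _<_; _≤_; z≤n; s≤s)
import Data.Nat.Properties as ℕ
open import Data.Nat.Combinatorics using (_C_; nC1≡n; nCk+nC[k+1]≡[n+1]C[k+1]; k>n⇒nCk≡0)
open import Data.Nat.Divisibility using (_∣_; divides; ∣⇒≤)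
open import Data.Nat.Primality using (Prime; euclidsLemma)
open import Data.Fin as Fin using (Fin; toℕ)
open import Data.Fin.Properties using (toℕ-inject₁; toℕ-fromℕ; toℕ≤pred[n])
open import Data.Fin.Permutation using (Permutation; permutation; _⟨$⟩ʳ_)
open import Data.Sum using (inj₁; inj₂)
open import Data.Product using (_,_)
open import Relation.Nullary using (¬_; yes; no; contradiction)
open import Relation.Nullary.Decidable using (via-injection)
open import Relation.Binary.Definitions using (Decidable)
open import Relation.Binary.PropositionalEquality as ≡ using (_≡_; cong; cong₂)
open import Function.Bundles using (Bijection; Inverse)
open import Function.Properties.Bijection using (Bijection⇒Inverse)
open import Function.Properties.Inverse using (Inverse⇒Injection)
import Function.Construct.Symmetry as Symmetry
open import Algebra.Bundles using (Monoid; Semiring; CommutativeRing)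
import Algebra.Properties.CommutativeSemiring.Binomial as Binomial

module _ where
  open import Data.Nat using (_+_; _*_)
  open import Data.Nat.Properties
    using (*-zeroʳ; *-identityˡ; *-identityʳ; *-comm; *-distribˡ-+; +-assoc; <⇒≱)
  open import Data.Nat.Solver using (module +-*-Solver)

  [k+1]*[n+1]C[k+1]≡[n+1]*nCk : ∀ n k → suc k * (suc n C suc k) ≡ suc n * (n C k)
  [k+1]*[n+1]C[k+1]≡[n+1]*nCk n       zero    =
    ≡.trans (*-identityˡ (suc n C 1)) (≡.trans (nC1≡n (suc n)) (≡.sym (*-identityʳ (suc n))))
  [k+1]*[n+1]C[k+1]≡[n+1]*nCk zero    (suc k) = *-zeroʳ (suc (suc k))
  [k+1]*[n+1]C[k+1]≡[n+1]*nCk (suc n) (suc k) = begin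
    suc (suc k) * (suc (suc n) C suc (suc k))
      ≡⟨ cong (suc (suc k) *_) (nCk+nC[k+1]≡[n+1]C[k+1] (suc n) (suc k)) ⟨
    suc (suc k) * (A + B)
      ≡⟨ *-distribˡ-+ (suc (suc k)) A B ⟩
    A + suc k * A + suc (suc k) * B
      ≡⟨ +-assoc A (suc k * A) (suc (suc k) * B) ⟩
    A + (suc k * A + suc (suc k) * B)
      ≡⟨ cong (A +_) (cong₂ _+_ ([k+1]*[n+1]C[k+1]≡[n+1]*nCk n k)
                                ([k+1]*[n+1]C[k+1]≡[n+1]*nCk n (suc k))) ⟩
    A + (suc n * (n C k) + suc n * (n C suc k))
      ≡⟨ cong (A +_) (*-distribˡ-+ (suc n) (n C k) (n C suc k)) ⟨
    A + suc n * (n C k + n C suc k)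
      ≡⟨ cong (λ x → A + suc n * x) (nCk+nC[k+1]≡[n+1]C[k+1] n k) ⟩
    suc (suc n) * A ∎
    where
      open ≡.≡-Reasoning
      A B : ℕ
      A = suc n C suc k
      B = suc n C suc (suc k)

  p∣pCk : ∀ {p k} → Prime p → 0 < k → k < p → p ∣ p C k
  p∣pCk {suc n} {suc l} pr 0<k k<p
    with euclidsLemma (suc l) (suc n C suc l) pr
           (divides (n C l) (≡.trans ([k+1]*[n+1]C[k+1]≡[n+1]*nCk n l) (*-comm (suc n) (n C l))))
  ... | inj₁ p∣k = contradiction (∣⇒≤ p∣k) (<⇒≱ k<p)
  ... | inj₂ p∣C = p∣C

  [i+1]C[l+1]*[j+1]C[l+1]-pascal : ∀ i j l →
    (suc i C suc l) * (suc j C suc l) + (i C suc l) * (j C suc l) ≡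
    ((i C suc l) * (suc j C suc l) + (suc i C suc l) * (j C suc l)) + (i C l) * (j C l)
  [i+1]C[l+1]*[j+1]C[l+1]-pascal i j l = begin
    (suc i C suc l) * (suc j C suc l) + a₁ * b₁
      ≡⟨ cong₂ (λ x y → x * y + a₁ * b₁) (pascal i) (pascal j) ⟨
    (a + a₁) * (b + b₁) + a₁ * b₁
      ≡⟨ solve 4 (λ a a₁ b b₁ → (a :+ a₁) :* (b :+ b₁) :+ a₁ :* b₁
                             := (a₁ :* (b :+ b₁) :+ (a :+ a₁) :* b₁) :+ a :* b)
                 ≡.refl a a₁ b b₁ ⟩
    (a₁ * (b + b₁) + (a + a₁) * b₁) + a * b
      ≡⟨ cong₂ (λ x y → (a₁ * y + x * b₁) + a * b) (pascal i) (pascal j) ⟩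
    (a₁ * (suc j C suc l) + (suc i C suc l) * b₁) + a * b ∎
    where
      open ≡.≡-Reasoning
      open +-*-Solver
      pascal : ∀ n → n C l + n C suc l ≡ suc n C suc l
      pascal n = nCk+nC[k+1]≡[n+1]C[k+1] n l
      a a₁ b b₁ : ℕ
      a  = i C l
      a₁ = i C suc l
      b  = j C l
      b₁ = j C suc l

module _ {a ℓ : Level} (M : Monoid a ℓ) where
  open Monoid M renaming (_∙_ to _+_; ε to 0#)
  open import Algebra.Properties.Monoid.Sum M

  ∑-extendʳ : (f : ℕ → Carrier) (N : ℕ) → f N ≈ 0# →
              ∑[ l < suc N ] f (toℕ l) ≈ ∑[ l < N ] f (toℕ l)
  ∑-extendʳ f N fN≈0 = trans (sum-init-last (λ l → f (toℕ l)))
    (trans (∙-cong (sum-cong-≋ {N} (λ l → reflexive (cong f (toℕ-inject₁ l))))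
                   (trans (reflexive (cong f (toℕ-fromℕ N))) fN≈0))
           (identityʳ _))

  ∑-head : (f : ℕ → Carrier) (N : ℕ) → (∀ l → f (suc l) ≈ 0#) →
           ∑[ l < suc N ] f (toℕ l) ≈ f 0
  ∑-head f N tail≈0 =
    trans (∙-congˡ (trans (sum-cong-≋ {N} (λ l → tail≈0 (toℕ l))) (sum-replicate-zero N)))
          (identityʳ (f 0))

module _ {c ℓ : Level} (S : Semiring c ℓ) where
  open Semiring S
  open import Algebra.Properties.Semiring.Mult S
  open import Algebra.Properties.Semiring.Exp S

  1#^n≈1# : ∀ n → 1# ^ n ≈ 1#
  1#^n≈1# zero    = refl
  1#^n≈1# (suc n) = trans (*-identityˡ _) (1#^n≈1# n)

  ×1-homo-^ : ∀ m n → (m ℕ.^ n) × 1# ≈ (m × 1#) ^ n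
  ×1-homo-^ m zero    = +-identityʳ 1#
  ×1-homo-^ m (suc n) = trans (×1-homo-* m (m ℕ.^ n)) (*-congˡ (×1-homo-^ m n))

  ∣⇒×1#≈0# : ∀ {p n} → p × 1# ≈ 0# → p ∣ n → n × 1# ≈ 0#
  ∣⇒×1#≈0# {p} p×1≈0 (divides k ≡.refl) =
    trans (×1-homo-* k p) (trans (*-congˡ p×1≈0) (zeroʳ _))

module _ {c ℓ : Level} (R : CommutativeRing c ℓ) where
  open CommutativeRing R
  open import Algebra.Properties.Semiring.Mult semiring
  open import Algebra.Properties.Semiring.Exp semiring
  open import Algebra.Properties.Semiring.Sum semiring
  open import Algebra.Properties.CommutativeSemigroup +-commutativeSemigroup using (xy∙z≈zy∙x)
  open import Algebra.Properties.Group +-group using (∙-cancelʳ)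
  open import Algebra.Solver.Ring.NaturalCoefficients.Default commutativeSemiring
  open import Relation.Binary.Reasoning.Setoid setoid

  Fentry-sym : ∀ m i j → Fentry R m i j ≈ Fentry R m j i
  Fentry-sym m zero    zero    = refl
  Fentry-sym m zero    (suc j) = refl
  Fentry-sym m (suc i) zero    = refl
  Fentry-sym m (suc i) (suc j) = begin
    (F i (suc j) + m * F i j) + F (suc i) j
      ≈⟨ +-cong (+-cong (Fentry-sym m i (suc j)) (*-congˡ (Fentry-sym m i j)))
                (Fentry-sym m (suc i) j) ⟩
    (F (suc j) i + m * F j i) + F j (suc i)
      ≈⟨ xy∙z≈zy∙x _ _ _ ⟩
    (F j (suc i) + m * F j i) + F (suc j) i ∎
    where
      F : ℕ → ℕ → Carrier
      F = Fentry R m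

  -- delannoy 2 N i j is the Delannoy number D(i,j) once N > min(i,j).
  delannoyTerm : Carrier → ℕ → ℕ → ℕ → Carrier
  delannoyTerm t i j l = ((i C l) ℕ.* (j C l)) × t ^ l

  delannoy : Carrier → ℕ → ℕ → ℕ → Carrier
  delannoy t N i j = ∑[ l < N ] delannoyTerm t i j (toℕ l)

  delannoyTerm-vanishesˡ : ∀ t {i} j l → i < l → delannoyTerm t i j l ≈ 0#
  delannoyTerm-vanishesˡ t j l i<l = ×-congˡ {t ^ l} (cong (ℕ._* (j C l)) (k>n⇒nCk≡0 i<l))

  delannoyTerm-vanishesʳ : ∀ t i {j} l → j < l → delannoyTerm t i j l ≈ 0#
  delannoyTerm-vanishesʳ t i l j<l =
    ×-congˡ {t ^ l} (≡.trans (cong ((i C l) ℕ.*_) (k>n⇒nCk≡0 j<l)) (ℕ.*-zeroʳ (i C l)))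

  delannoyTerm-pascal : ∀ t i j l →
    delannoyTerm t (suc i) (suc j) (suc l) + delannoyTerm t i j (suc l) ≈
    (delannoyTerm t i (suc j) (suc l) + delannoyTerm t (suc i) j (suc l)) + t * delannoyTerm t i j l
  delannoyTerm-pascal t i j l = begin
    d (suc i) (suc j) × t ^ suc l + d i j × t ^ suc l
      ≈⟨ ×-homo-+ _ (d (suc i) (suc j)) (d i j) ⟨
    (d (suc i) (suc j) ℕ.+ d i j) × t ^ suc l
      ≈⟨ ×-congˡ ([i+1]C[l+1]*[j+1]C[l+1]-pascal i j l) ⟩
    ((d i (suc j) ℕ.+ d (suc i) j) ℕ.+ (i C l) ℕ.* (j C l)) × t ^ suc l
      ≈⟨ ×-homo-+ _ (d i (suc j) ℕ.+ d (suc i) j) _ ⟩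
    (d i (suc j) ℕ.+ d (suc i) j) × t ^ suc l + ((i C l) ℕ.* (j C l)) × t ^ suc l
      ≈⟨ +-cong (×-homo-+ _ (d i (suc j)) (d (suc i) j))
                (sym (×-comm-* ((i C l) ℕ.* (j C l)) t (t ^ l))) ⟩
    (d i (suc j) × t ^ suc l + d (suc i) j × t ^ suc l) + t * delannoyTerm t i j l ∎
    where
      d : ℕ → ℕ → ℕ
      d i j = (i C suc l) ℕ.* (j C suc l)

  delannoy-pascal : ∀ t {i} j N → i < N →
    let S = delannoy t (suc N) in
    S (suc i) (suc j) + S i j ≈ (S i (suc j) + S (suc i) j) + t * S i j
  delannoy-pascal t {i} j N i<N = begin
    S (suc i) (suc j) + S i j
      ≈⟨ ∑-distrib-+ {suc N} (λ l → T (suc i) (suc j) (toℕ l)) (λ l → T i j (toℕ l)) ⟨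
    U 0 + ∑[ l < N ] U (suc (toℕ l))
      ≈⟨ +-congˡ (sum-cong-≋ {N} (λ l → delannoyTerm-pascal t i j (toℕ l))) ⟩
    V 0 + ∑[ l < N ] (V (suc (toℕ l)) + t * T i j (toℕ l))
      ≈⟨ +-congˡ (∑-distrib-+ {N} (λ l → V (suc (toℕ l))) (λ l → t * T i j (toℕ l))) ⟩
    V 0 + (∑[ l < N ] V (suc (toℕ l)) + ∑[ l < N ] (t * T i j (toℕ l)))
      ≈⟨ +-assoc _ _ _ ⟨
    ∑[ l < suc N ] V (toℕ l) + ∑[ l < N ] (t * T i j (toℕ l))
      ≈⟨ +-cong (∑-distrib-+ {suc N} (λ l → T i (suc j) (toℕ l)) (λ l → T (suc i) j (toℕ l)))
                (sym (*-distribˡ-sum {N} t (λ l → T i j (toℕ l)))) ⟩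
    (S i (suc j) + S (suc i) j) + t * ∑[ l < N ] T i j (toℕ l)
      ≈⟨ +-congˡ (*-congˡ (∑-extendʳ +-monoid (T i j) N (delannoyTerm-vanishesˡ t j N i<N))) ⟨
    (S i (suc j) + S (suc i) j) + t * S i j ∎
    where
      S : ℕ → ℕ → Carrier
      S = delannoy t (suc N)
      T : ℕ → ℕ → ℕ → Carrier
      T = delannoyTerm t
      U V : ℕ → Carrier
      U l = T (suc i) (suc j) l + T i j l
      V l = T i (suc j) l + T (suc i) j l

  delannoy-rec : ∀ m {i} j N → i < N →
    let S = delannoy (1# + m) (suc N) in
    S (suc i) (suc j) ≈ (S i (suc j) + m * S i j) + S (suc i) j
  delannoy-rec m {i} j N i<N = ∙-cancelʳ (S i j) _ _ (begin
    S (suc i) (suc j) + S i j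
      ≈⟨ delannoy-pascal (1# + m) j N i<N ⟩
    (S i (suc j) + S (suc i) j) + (1# + m) * S i j
      ≈⟨ solve 4 (λ a b m e → (a :+ b) :+ (con 1 :+ m) :* e := ((a :+ m :* e) :+ b) :+ e)
               refl (S i (suc j)) (S (suc i) j) m (S i j) ⟩
    ((S i (suc j) + m * S i j) + S (suc i) j) + S i j ∎)
    where
      S : ℕ → ℕ → Carrier
      S = delannoy (1# + m) (suc N)

  Fentry≈delannoy : ∀ m i j N → i < N → Fentry R m i j ≈ delannoy (1# + m) N i j
  Fentry≈delannoy m zero    j       (suc N) _ = sym (begin
    delannoy (1# + m) (suc N) 0 j
      ≈⟨ ∑-head +-monoid (delannoyTerm (1# + m) 0 j) N
                (λ l → delannoyTerm-vanishesˡ (1# + m) j (suc l) (s≤s z≤n)) ⟩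
    1# + 0#
      ≈⟨ +-identityʳ 1# ⟩
    1# ∎)
  Fentry≈delannoy m (suc i) zero    (suc N) _ = sym (begin
    delannoy (1# + m) (suc N) (suc i) 0
      ≈⟨ ∑-head +-monoid (delannoyTerm (1# + m) (suc i) 0) N
                (λ l → delannoyTerm-vanishesʳ (1# + m) (suc i) (suc l) (s≤s z≤n)) ⟩
    1# + 0#
      ≈⟨ +-identityʳ 1# ⟩
    1# ∎)
  Fentry≈delannoy m (suc i) (suc j) (suc N) (s≤s i<N) = begin
    (Fentry R m i (suc j) + m * Fentry R m i j) + Fentry R m (suc i) j
      ≈⟨ +-cong (+-cong (Fentry≈delannoy m i (suc j) (suc N) i<1+N)
                        (*-congˡ (Fentry≈delannoy m i j (suc N) i<1+N)))
                (Fentry≈delannoy m (suc i) j (suc N) (s≤s i<N)) ⟩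
    (S i (suc j) + m * S i j) + S (suc i) j
      ≈⟨ delannoy-rec m j N i<N ⟨
    S (suc i) (suc j) ∎
    where
      S : ℕ → ℕ → Carrier
      S = delannoy (1# + m) (suc N)
      i<1+N : i < suc N
      i<1+N = ℕ.m<n⇒m<1+n i<N

module _ {c ℓ : Level} (R : CommutativeRing c ℓ) where
  open CommutativeRing R
  open import Algebra.Properties.Semiring.Mult semiring
  open import Algebra.Properties.CommutativeSemiring.Exp commutativeSemiring
  open import Algebra.Properties.Semiring.Sum semiring
  open import Algebra.Properties.Ring ring using (-1*x≈-x)
  open import Algebra.Properties.Group +-group using (inverseʳ-unique)
  open import Algebra.Properties.CommutativeSemigroup +-commutativeSemigroup using (x∙yz≈zx∙y)
  open Binomial commutativeSemiring using (binomialExpansion) renaming (theorem to binomial-theorem)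
  open import Relation.Binary.Reasoning.Setoid setoid

  [p-1]Cl×1≈[-1]^l : ∀ {p} → Prime p → p × 1# ≈ 0# →
                     ∀ l → l < p → ((p ∸ 1) C l) × 1# ≈ (- 1#) ^ l
  [p-1]Cl×1≈[-1]^l {suc Q} pr char zero    _      = +-identityʳ 1#
  [p-1]Cl×1≈[-1]^l {suc Q} pr char (suc l) l+1<p = begin
    (Q C suc l) × 1#
      ≈⟨ inverseʳ-unique _ _ pascal-vanishes ⟩
    - ((Q C l) × 1#)
      ≈⟨ -‿cong ([p-1]Cl×1≈[-1]^l pr char l (ℕ.<-trans (ℕ.n<1+n l) l+1<p)) ⟩
    - ((- 1#) ^ l)
      ≈⟨ -1*x≈-x _ ⟨
    - 1# * (- 1#) ^ l ∎
    where
      pascal-vanishes : (Q C l) × 1# + (Q C suc l) × 1# ≈ 0#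
      pascal-vanishes = begin
        (Q C l) × 1# + (Q C suc l) × 1#  ≈⟨ ×-homo-+ 1# (Q C l) (Q C suc l) ⟨
        (Q C l ℕ.+ Q C suc l) × 1#        ≈⟨ ×-congˡ (nCk+nC[k+1]≡[n+1]C[k+1] Q l) ⟩
        (suc Q C suc l) × 1#              ≈⟨ ∣⇒×1#≈0# semiring char (p∣pCk pr (s≤s z≤n) l+1<p) ⟩
        0# ∎

  [p-1]Cl×x^l≈[-x]^l : ∀ {p} → Prime p → p × 1# ≈ 0# →
                       ∀ x l → l < p → ((p ∸ 1) C l) × x ^ l ≈ (- x) ^ l
  [p-1]Cl×x^l≈[-x]^l {p} pr char x l l<p = begin
    b × x ^ l          ≈⟨ ×-congʳ b (*-identityˡ (x ^ l)) ⟨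
    b × (1# * x ^ l)   ≈⟨ ×-assoc-* b 1# (x ^ l) ⟨
    (b × 1#) * x ^ l   ≈⟨ *-congʳ ([p-1]Cl×1≈[-1]^l pr char l l<p) ⟩
    (- 1#) ^ l * x ^ l ≈⟨ ^-distrib-* (- 1#) x l ⟨
    (- 1# * x) ^ l     ≈⟨ ^-congˡ l (-1*x≈-x x) ⟩
    (- x) ^ l ∎
    where
      b : ℕ
      b = (p ∸ 1) C l

  Fentry-lastColumn : ∀ {p} → Prime p → p × 1# ≈ 0# →
                      ∀ m k → k < p → Fentry R m k (p ∸ 1) ≈ (- m) ^ k
  Fentry-lastColumn {p} pr char m k k<p = begin
    Fentry R m k (p ∸ 1)
      ≈⟨ Fentry≈delannoy R m k (p ∸ 1) (suc k) (ℕ.n<1+n k) ⟩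
    delannoy R t (suc k) k (p ∸ 1)
      ≈⟨ sum-cong-≋ {suc k} (λ l → term (toℕ l) (toℕ≤pred[n] l)) ⟩
    binomialExpansion (- t) 1# k
      ≈⟨ binomial-theorem k (- t) 1# ⟨
    (- t + 1#) ^ k
      ≈⟨ ^-congˡ k (inverseʳ-unique m (- t + 1#) m+[-t+1]≈0) ⟩
    (- m) ^ k ∎
    where
      t : Carrier
      t = 1# + m
      term : ∀ l → l ≤ k → delannoyTerm R t k (p ∸ 1) l ≈ (k C l) × ((- t) ^ l * 1# ^ (k ∸ l))
      term l l≤k = begin
        ((k C l) ℕ.* ((p ∸ 1) C l)) × t ^ l
          ≈⟨ ×-assocˡ (t ^ l) (k C l) ((p ∸ 1) C l) ⟨
        (k C l) × (((p ∸ 1) C l) × t ^ l)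
          ≈⟨ ×-congʳ (k C l) ([p-1]Cl×x^l≈[-x]^l pr char t l (ℕ.≤-<-trans l≤k k<p)) ⟩
        (k C l) × (- t) ^ l
          ≈⟨ ×-congʳ (k C l) (trans (*-congˡ (1#^n≈1# semiring (k ∸ l))) (*-identityʳ _)) ⟨
        (k C l) × ((- t) ^ l * 1# ^ (k ∸ l)) ∎
      m+[-t+1]≈0 : m + (- t + 1#) ≈ 0#
      m+[-t+1]≈0 = trans (x∙yz≈zx∙y m (- t) 1#) (-‿inverseʳ t)

module _ {c ℓ : Level} (R : CommutativeRing c ℓ) {q : ℕ}
         (card : Bijection (≡.setoid (Fin q)) (CommutativeRing.setoid R)) where
  open CommutativeRing R
  open import Algebra.Properties.Semiring.Mult semiring
  open import Algebra.Properties.Semiring.Sum semiring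
  open import Algebra.Properties.Group +-group using (∙-cancelˡ; //-rightDividesˡ; //-rightDividesʳ)
  open import Relation.Binary.Reasoning.Setoid setoid
  open Inverse (Bijection⇒Inverse card)

  ≈-dec : Decidable _≈_
  ≈-dec = via-injection (Inverse⇒Injection (Symmetry.inverse (Bijection⇒Inverse card))) Fin._≟_

  q×1#≈0# : q × 1# ≈ 0#
  q×1#≈0# = ∙-cancelˡ (∑[ i < q ] to i) _ _ (begin
    ∑[ i < q ] to i + q × 1#             ≈⟨ +-congˡ (sum-replicate q) ⟨
    ∑[ i < q ] to i + ∑[ i < q ] 1#      ≈⟨ ∑-distrib-+ {q} to (λ _ → 1#) ⟨
    ∑[ i < q ] (to i + 1#)               ≈⟨ sum-cong-≋ {q} (λ i → strictlyInverseˡ (to i + 1#)) ⟨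
    ∑[ i < q ] to (translation ⟨$⟩ʳ i)   ≈⟨ ∑-permute to translation ⟨
    ∑[ i < q ] to i                      ≈⟨ +-identityʳ _ ⟨
    ∑[ i < q ] to i + 0# ∎)
    where
      translation : Permutation q q
      translation = permutation (λ i → from (to i + 1#)) (λ i → from (to i - 1#))
        (λ i → ≡.trans (from-cong (trans (+-congʳ (strictlyInverseˡ _)) (//-rightDividesˡ 1# (to i))))
                       (strictlyInverseʳ i))
        (λ i → ≡.trans (from-cong (trans (+-congʳ (strictlyInverseˡ _)) (//-rightDividesʳ 1# (to i))))
                       (strictlyInverseʳ i))

module _ {c ℓ : Level} (R : CommutativeRing c ℓ) (isField : IsField R)
         (_≟_ : Decidable (CommutativeRing._≈_ R)) where
  open CommutativeRing R
  open IsField isField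
  open import Algebra.Properties.Semiring.Exp semiring
  open import Relation.Binary.Reasoning.Setoid setoid

  x≉0∧xy≈0⇒y≈0 : ∀ {x y} → ¬ x ≈ 0# → x * y ≈ 0# → y ≈ 0#
  x≉0∧xy≈0⇒y≈0 {x} {y} x≉0 xy≈0 with inverse x x≉0
  ... | x⁻¹ , x*x⁻¹≈1 = begin
    y                ≈⟨ *-identityˡ y ⟨
    1# * y           ≈⟨ *-congʳ (trans (*-comm x⁻¹ x) x*x⁻¹≈1) ⟨
    (x⁻¹ * x) * y    ≈⟨ *-assoc x⁻¹ x y ⟩
    x⁻¹ * (x * y)    ≈⟨ *-congˡ xy≈0 ⟩
    x⁻¹ * 0#         ≈⟨ zeroʳ x⁻¹ ⟩
    0# ∎

  x^n≈0⇒x≈0 : ∀ x n → x ^ n ≈ 0# → x ≈ 0#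
  x^n≈0⇒x≈0 x zero    1≈0    = contradiction 1≈0 1≉0
  x^n≈0⇒x≈0 x (suc n) xⁿ⁺¹≈0 with x ≟ 0#
  ... | yes x≈0 = x≈0
  ... | no  x≉0 = x^n≈0⇒x≈0 x n (x≉0∧xy≈0⇒y≈0 x≉0 xⁿ⁺¹≈0)

module _ {c ℓ : Level} (R : CommutativeRing c ℓ) where
  open CommutativeRing R
  open import Algebra.Properties.Semiring.Mult semiring

  finiteField-char : ∀ {p n q} → IsFiniteFieldOfSize R q → q ≡ p ℕ.^ n → p × 1# ≈ 0#
  finiteField-char {p} {n} FF ≡.refl =
    x^n≈0⇒x≈0 R isField (≈-dec R card) (p × 1#) n
      (trans (sym (×1-homo-^ semiring p n)) (q×1#≈0# R card))
    where open IsFiniteFieldOfSize FF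

-- Imported only here: above, _^_ and _×_ are the ring power and ℕ-multiple.
open import Data.Nat using (_^_)
open import Data.Product using (_×_)

lemma3p1 : {c ℓ : Level} (p : ℕ) → Prime p → (n q : ℕ) → q ≡ p ^ n →
    (R : CommutativeRing c ℓ) → IsFiniteFieldOfSize R q →
    (m : CommutativeRing.Carrier R) → (k : ℕ) → k < p →
    CommutativeRing._≈_ R (Fentry R m (p ∸ 1) k) (pow R (CommutativeRing.-_ R m) k)
    × CommutativeRing._≈_ R (Fentry R m k (p ∸ 1)) (pow R (CommutativeRing.-_ R m) k)
lemma3p1 p pr n q q≡pⁿ R FF m k k<p = trans (Fentry-sym R m (p ∸ 1) k) lastColumn , lastColumn
  where
    open CommutativeRing R using (_≈_; -_; trans)
    lastColumn : Fentry R m k (p ∸ 1) ≈ pow R (- m) k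
    lastColumn = Fentry-lastColumn R pr (finiteField-char R {p} {n} FF q≡pⁿ) m k k<p
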